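{- Let $\pi$ be a $(d-1)$-dimensional partition and $n\ge 0$. Then $$g_{\pi}(1, x_1,\ldots, x_n) = \sum_{\rho \subseteq \pi} g_{\rho}(x_1,\ldots, x_n),$$ where the sum runs over all $(d-1)$-dimensional partitions $\rho$ with $D(\rho)\subseteq D(\pi)$.
   Context: A $k$-dimensional partition is an array $\pi=(\pi_{\mathbf{i}})_{\mathbf{i}\in\mathbb{Z}_+^k}$ of nonnegative integers with finitely many nonzero entries, weakly decreasing in each coordinate; $D(\pi)=\{(\mathbf{i},i)\in\mathbb{Z}_+^{k+1}:1\le i\le\pi_{\mathbf{i}}\}$. For a $d$-dimensional partition $\tau$: $\mathrm{Cor}(\tau)=\{\mathbf{i}\in D(\tau):\mathbf{i}+\mathbf{e}_\ell\notin D(\tau)\ \forall\ell\in[d]\}$ ($\mathbf{e}_\ell$ standard basis of $\mathbb{Z}^{d+1}$), $\mathrm{sh}_1(\tau)=\{(i_2,\ldots,i_{d+1}):(i_1,\ldots,i_{d+1})\in D(\tau)\}$, and $c_i(\tau)=|\{\mathbf{i}:(i,\mathbf{i})\in\mathrm{Cor}(\tau)\}|$. For a $(d-1)$-dimensional partition $\rho$ and variables $\mathbf{x}=(x_1,\ldots,x_m)$, the (single-set) $d$-dimensional Grothendieck polynomial is $g_\rho(x_1,\ldots,x_m)=\sum_{\tau}\prod_{i=1}^m x_i^{c_i(\tau)}$, summed over $d$-dimensional partitions $\tau$ with $D(\tau)\subseteq[m]\times\mathbb{Z}_+^d$ and $\mathrm{sh}_1(\tau)=D(\rho)$. -}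

module Defs where

open import Level using (0ℓ)
open import Data.Nat using (ℕ; zero; suc; _≤_; _<_)
open import Data.Fin using (Fin; toℕ)
open import Data.Vec using (Vec; _∷_; updateAt)
open import Data.List using (List; length)
open import Data.List.Membership.Propositional using (_∈_)
open import Data.List.Relation.Unary.Unique.Propositional using (Unique)
open import Data.Product using (Σ; ∃; _×_; _,_; proj₁)
open import Relation.Nullary using (¬_)
open import Relation.Binary.PropositionalEquality using (_≡_; _≢_; refl; sym; trans)
open import Relation.Binary.Bundles using (Setoid)
open import Function.Bundles using (_⇔_)

-- Conventions: Z_+ = {1,2,...} is encoded 0-based by ℕ (index p ↦ p-1);
-- points of Z_+^k are vectors Vec ℕ k, and the j-th value layer 1 ≤ j ≤ π_i
-- becomes 0 ≤ j < π_i.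

_+e_ : ∀ {k} → Vec ℕ k → Fin k → Vec ℕ k
i +e ℓ = updateAt i ℓ suc

record Partition (k : ℕ) : Set where
  field
    arr    : Vec ℕ k → ℕ
    mono   : ∀ (i : Vec ℕ k) (ℓ : Fin k) → arr (i +e ℓ) ≤ arr i
    finite : Σ (List (Vec ℕ k)) λ L → ∀ i → arr i ≢ 0 → i ∈ L
open Partition public

InD : ∀ {k} → Partition k → Vec ℕ k → ℕ → Set
InD π i j = j < arr π i

_⊆ᴰ_ : ∀ {k} → Partition k → Partition k → Set
ρ ⊆ᴰ π = ∀ i j → InD ρ i j → InD π i j

_≈ᴾ_ : ∀ {k} → Partition k → Partition k → Set
π ≈ᴾ σ = ∀ i → arr π i ≡ arr σ i

IsCorner : ∀ {e} → Partition (suc e) → Vec ℕ (suc e) → ℕ → Set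
IsCorner τ i j = InD τ i j × (∀ (ℓ : Fin _) → ¬ InD τ (i +e ℓ) j)

CornerCount : ∀ {e} → Partition (suc e) → ℕ → ℕ → Set
CornerCount {e} τ p c =
  Σ (List (Vec ℕ e × ℕ)) λ L →
    Unique L × (∀ r j → ((r , j) ∈ L) ⇔ IsCorner τ (p ∷ r) j) × length L ≡ c

Admissible : ∀ {e} → ℕ → Partition e → Partition (suc e) → Set
Admissible m ρ τ =
  (∀ i₁ r j → InD τ (i₁ ∷ r) j → i₁ < m)
  × (∀ r j → ((Σ ℕ λ i₁ → InD τ (i₁ ∷ r) j)) ⇔ InD ρ r j)

-- Index set of the monomial x^a (a = exponents of x₁..xₙ) in
-- g_π(1, x₁, …, xₙ): τ counted by g_π in n+1 variables with c_{k+2}(τ) = a_k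
-- (c₁(τ) arbitrary since the first variable is 1).
LHSTerms : ∀ {e} (n : ℕ) → Partition e → (Fin n → ℕ) → Set
LHSTerms {e} n π a =
  Σ (Partition (suc e)) λ τ →
    Admissible (suc n) π τ × (∀ k → CornerCount τ (suc (toℕ k)) (a k))

-- Index set of x^a in  Σ_{ρ ⊆ π} g_ρ(x₁, …, xₙ).
RHSTerms : ∀ {e} (n : ℕ) → Partition e → (Fin n → ℕ) → Set
RHSTerms {e} n π a =
  Σ (Partition e) λ ρ → ρ ⊆ᴰ π ×
    (Σ (Partition (suc e)) λ τ →
      Admissible n ρ τ × (∀ k → CornerCount τ (toℕ k) (a k)))

LHSSetoid : ∀ {e} (n : ℕ) → Partition e → (Fin n → ℕ) → Setoid 0ℓ 0ℓ
LHSSetoid n π a = record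
  { Carrier = LHSTerms n π a
  ; _≈_ = λ x y → proj₁ x ≈ᴾ proj₁ y
  ; isEquivalence = record
    { refl = λ i → refl
    ; sym = λ p i → sym (p i)
    ; trans = λ p q i → trans (p i) (q i) } }

RHSSetoid : ∀ {e} (n : ℕ) → Partition e → (Fin n → ℕ) → Setoid 0ℓ 0ℓ
RHSSetoid n π a = record
  { Carrier = RHSTerms n π a
  ; _≈_ = λ x y → (proj₁ x ≈ᴾ proj₁ y) × (proj₁ (Data.Product.proj₂ (Data.Product.proj₂ x)) ≈ᴾ proj₁ (Data.Product.proj₂ (Data.Product.proj₂ y)))
  ; isEquivalence = record
    { refl = (λ i → refl) , (λ i → refl)
    ; sym = λ { (p , q) → (λ i → sym (p i)) , (λ i → sym (q i)) }
    ; trans = λ { (p , q) (p' , q') → (λ i → trans (p i) (p' i)) , (λ i → trans (q i) (q' i)) } } }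

-- Since layers decrease, the first layer of a partition is its shadow; so every τ
-- counted by g_π(1, x₁, …, xₙ) has π as its first layer.  Deleting that layer leaves a
-- partition τ′ in n variables whose shadow ρ, the old second layer, lies in π; and any
-- such pair (ρ, τ′) comes from a unique τ by putting π back on top.  Corners in the
-- remaining layers only move down by one, so the weight in x₁, …, xₙ is unchanged.
module Submission where

open import Defs
open import Data.Nat using (ℕ; zero; suc; _≤_; _<_; z≤n; s≤s; pred)
open import Data.Nat.Properties using (≤-antisym; ≤-refl; ≤-trans; <-≤-trans; ≤-pred; n<1+n)
open import Data.Fin using (Fin; toℕ)
open import Data.Vec using (Vec; _∷_; tail; updateAt)
open import Data.List using (map; _++_)
open import Data.List.Membership.Propositional using (_∈_)
open import Data.List.Membership.Propositional.Properties using (∈-map⁺; ∈-++⁺ˡ; ∈-++⁺ʳ)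
open import Data.Product using (Σ; _,_; proj₁; proj₂)
open import Relation.Binary.PropositionalEquality using (_≡_; _≢_; refl; sym; subst)
open import Relation.Binary.Bundles using (Setoid)
open import Function.Base using (_∘_)
open import Function.Bundles using (Inverse; _⇔_; mk⇔; Equivalence)
open import Function.Definitions using (Congruent; Inverseˡ; Inverseʳ; StrictlyInverseˡ; StrictlyInverseʳ)
open import Function.Construct.Composition using (_⇔-∘_)
open import Function.Construct.Symmetry using (⇔-sym)
import Function.Consequences.Setoid as SetoidConsequences

open Equivalence using (to; from)

∀<⇒≤ : ∀ {m n} → (∀ j → j < m → j < n) → m ≤ n
∀<⇒≤ {zero}  _ = z≤n
∀<⇒≤ {suc m} below = below m (n<1+n m)

module _ {k : ℕ} where

  ⊆ᴰ⇒arr-≤ : {ρ π : Partition k} → ρ ⊆ᴰ π → ∀ i → arr ρ i ≤ arr π i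
  ⊆ᴰ⇒arr-≤ ρ⊆π i = ∀<⇒≤ (ρ⊆π i)

  ⊆ᴰ-antisym : {ρ π : Partition k} → ρ ⊆ᴰ π → π ⊆ᴰ ρ → ρ ≈ᴾ π
  ⊆ᴰ-antisym {ρ} {π} ρ⊆π π⊆ρ i = ≤-antisym (⊆ᴰ⇒arr-≤ {ρ} {π} ρ⊆π i) (⊆ᴰ⇒arr-≤ {π} {ρ} π⊆ρ i)

  ⊆ᴰ-trans : {σ ρ π : Partition k} → σ ⊆ᴰ ρ → ρ ⊆ᴰ π → σ ⊆ᴰ π
  ⊆ᴰ-trans σ⊆ρ ρ⊆π i j = ρ⊆π i j ∘ σ⊆ρ i j

module _ {e : ℕ} where

  layer : Partition (suc e) → ℕ → Partition e
  layer τ p = record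
    { arr    = λ r → arr τ (p ∷ r)
    ; mono   = λ r ℓ → mono τ (p ∷ r) (Fin.suc ℓ)
    ; finite = map tail (proj₁ (finite τ)) , λ r nz → ∈-map⁺ tail (proj₂ (finite τ) (p ∷ r) nz)
    }

  arr-≤-layer₀ : (τ : Partition (suc e)) → ∀ i r → arr τ (i ∷ r) ≤ arr τ (0 ∷ r)
  arr-≤-layer₀ τ zero    r = ≤-refl
  arr-≤-layer₀ τ (suc i) r = ≤-trans (mono τ (i ∷ r) Fin.zero) (arr-≤-layer₀ τ i r)

  shadow⇔layer₀ : (τ : Partition (suc e)) →
    ∀ r j → (Σ ℕ λ i → InD τ (i ∷ r) j) ⇔ InD (layer τ 0) r j
  shadow⇔layer₀ τ r j = mk⇔ (λ (i , x) → <-≤-trans x (arr-≤-layer₀ τ i r)) (0 ,_)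

  module _ {m : ℕ} (ρ : Partition e) (τ : Partition (suc e)) (adm : Admissible m ρ τ) where

    layer-⊆ᴰ-shadow : ∀ p → layer τ p ⊆ᴰ ρ
    layer-⊆ᴰ-shadow p r j x = to (proj₂ adm r j) (p , x)

    layer-⊆ᴰ : {π : Partition e} → ρ ⊆ᴰ π → ∀ p → layer τ p ⊆ᴰ π
    layer-⊆ᴰ {π} ρ⊆π p = ⊆ᴰ-trans {σ = layer τ p} {ρ} {π} (layer-⊆ᴰ-shadow p) ρ⊆π

    layer₀≈shadow : layer τ 0 ≈ᴾ ρ
    layer₀≈shadow = ⊆ᴰ-antisym {ρ = layer τ 0} {π = ρ} (layer-⊆ᴰ-shadow 0)
      (λ r j → to (shadow⇔layer₀ τ r j) ∘ from (proj₂ adm r j))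

  dropLayer : Partition (suc e) → Partition (suc e)
  dropLayer τ = record
    { arr    = shifted
    ; mono   = shifted-mono
    ; finite = map (λ i → updateAt i Fin.zero pred) (proj₁ (finite τ)) , shifted-finite
    }
    where
    shifted : Vec ℕ (suc e) → ℕ
    shifted (p ∷ r) = arr τ (suc p ∷ r)
    shifted-mono : ∀ i ℓ → shifted (i +e ℓ) ≤ shifted i
    shifted-mono (p ∷ r) Fin.zero    = mono τ (suc p ∷ r) Fin.zero
    shifted-mono (p ∷ r) (Fin.suc ℓ) = mono τ (suc p ∷ r) (Fin.suc ℓ)
    shifted-finite : ∀ i → shifted i ≢ 0 → i ∈ map (λ i → updateAt i Fin.zero pred) (proj₁ (finite τ))
    shifted-finite (p ∷ r) nz =
      ∈-map⁺ (λ i → updateAt i Fin.zero pred) (proj₂ (finite τ) (suc p ∷ r) nz)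

  prependLayer : (π : Partition e) (τ : Partition (suc e)) → layer τ 0 ⊆ᴰ π → Partition (suc e)
  prependLayer π τ τ₀⊆π = record
    { arr    = extended
    ; mono   = extended-mono
    ; finite = map (0 ∷_) (proj₁ (finite π)) ++ map (_+e Fin.zero) (proj₁ (finite τ))
             , extended-finite
    }
    where
    extended : Vec ℕ (suc e) → ℕ
    extended (zero  ∷ r) = arr π r
    extended (suc p ∷ r) = arr τ (p ∷ r)
    extended-mono : ∀ i ℓ → extended (i +e ℓ) ≤ extended i
    extended-mono (zero  ∷ r) Fin.zero    = ⊆ᴰ⇒arr-≤ {ρ = layer τ 0} {π = π} τ₀⊆π r
    extended-mono (suc p ∷ r) Fin.zero    = mono τ (p ∷ r) Fin.zero
    extended-mono (zero  ∷ r) (Fin.suc ℓ) = mono π r ℓ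
    extended-mono (suc p ∷ r) (Fin.suc ℓ) = mono τ (p ∷ r) (Fin.suc ℓ)
    extended-finite : ∀ i → extended i ≢ 0 →
      i ∈ map (0 ∷_) (proj₁ (finite π)) ++ map (_+e Fin.zero) (proj₁ (finite τ))
    extended-finite (zero ∷ r) nz = ∈-++⁺ˡ (∈-map⁺ (0 ∷_) (proj₂ (finite π) r nz))
    extended-finite (suc p ∷ r) nz =
      ∈-++⁺ʳ (map (0 ∷_) (proj₁ (finite π))) (∈-map⁺ (_+e Fin.zero) (proj₂ (finite τ) (p ∷ r) nz))

  dropLayer-admissible : ∀ {m} {ρ : Partition e} (τ : Partition (suc e)) →
    Admissible (suc m) ρ τ → Admissible m (layer τ 1) (dropLayer τ)
  dropLayer-admissible τ (bounded , _) =
    (λ i r j x → ≤-pred (bounded (suc i) r j x)) , shadow⇔layer₀ (dropLayer τ)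

  prependLayer-admissible : ∀ {m} {π ρ : Partition e} (τ : Partition (suc e)) h →
    Admissible m ρ τ → Admissible (suc m) π (prependLayer π τ h)
  prependLayer-admissible {m} {π} τ h (bounded , _) = bounded′ , shadow⇔layer₀ (prependLayer π τ h)
    where
    bounded′ : ∀ i r j → InD (prependLayer π τ h) (i ∷ r) j → i < suc m
    bounded′ zero    r j x = s≤s z≤n
    bounded′ (suc i) r j x = s≤s (bounded i r j x)

  dropLayer-cong : {τ σ : Partition (suc e)} → τ ≈ᴾ σ → dropLayer τ ≈ᴾ dropLayer σ
  dropLayer-cong τ≈σ (p ∷ r) = τ≈σ (suc p ∷ r)

  prependLayer-cong : {π : Partition e} {τ σ : Partition (suc e)}
    (h : layer τ 0 ⊆ᴰ π) (h′ : layer σ 0 ⊆ᴰ π) → τ ≈ᴾ σ → prependLayer π τ h ≈ᴾ prependLayer π σ h′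
  prependLayer-cong _ _ τ≈σ (zero  ∷ r) = refl
  prependLayer-cong _ _ τ≈σ (suc p ∷ r) = τ≈σ (p ∷ r)

  dropLayer-prependLayer : ∀ {π : Partition e} {τ : Partition (suc e)} h →
    dropLayer (prependLayer π τ h) ≈ᴾ τ
  dropLayer-prependLayer _ (p ∷ r) = refl

  prependLayer-dropLayer : ∀ {m} (π : Partition e) (τ : Partition (suc e)) →
    Admissible m π τ → ∀ h → prependLayer π (dropLayer τ) h ≈ᴾ τ
  prependLayer-dropLayer π τ adm _ (zero  ∷ r) = sym (layer₀≈shadow π τ adm r)
  prependLayer-dropLayer π τ adm _ (suc p ∷ r) = refl

  module _ {τ τ′ : Partition (suc e)} (shift : ∀ p r → arr τ (suc p ∷ r) ≡ arr τ′ (p ∷ r)) where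

    inD-shift : ∀ p r j → InD τ (suc p ∷ r) j ⇔ InD τ′ (p ∷ r) j
    inD-shift p r j = mk⇔ (subst (j <_) (shift p r)) (subst (j <_) (sym (shift p r)))

    inD-shift-+e : ∀ p r ℓ j → InD τ ((suc p ∷ r) +e ℓ) j ⇔ InD τ′ ((p ∷ r) +e ℓ) j
    inD-shift-+e p r Fin.zero    = inD-shift (suc p) r
    inD-shift-+e p r (Fin.suc ℓ) = inD-shift p (r +e ℓ)

    isCorner-shift : ∀ p r j → IsCorner τ (suc p ∷ r) j ⇔ IsCorner τ′ (p ∷ r) j
    isCorner-shift p r j = mk⇔
      (λ (x , maximal) → to (inD-shift p r j) x , λ ℓ → maximal ℓ ∘ from (inD-shift-+e p r ℓ j))
      (λ (x , maximal) → from (inD-shift p r j) x , λ ℓ → maximal ℓ ∘ to (inD-shift-+e p r ℓ j))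

    cornerCount-shift : ∀ p c → CornerCount τ (suc p) c ⇔ CornerCount τ′ p c
    cornerCount-shift p c = mk⇔
      (λ (L , unique , enum , len) → L , unique , (λ r j → isCorner-shift p r j ⇔-∘ enum r j) , len)
      (λ (L , unique , enum , len) → L , unique , (λ r j → ⇔-sym (isCorner-shift p r j) ⇔-∘ enum r j) , len)

module FirstLayer {e : ℕ} (π : Partition e) (n : ℕ) (a : Fin n → ℕ) where

  open Setoid (LHSSetoid n π a) using () renaming (_≈_ to _≈ᴸ_)
  open Setoid (RHSSetoid n π a) using () renaming (_≈_ to _≈ᴿ_)
  open SetoidConsequences (LHSSetoid n π a) (RHSSetoid n π a)

  remove : LHSTerms n π a → RHSTerms n π a
  remove (τ , adm , corners) =
    layer τ 1 , layer-⊆ᴰ-shadow π τ adm 1 , dropLayer τ , dropLayer-admissible {ρ = π} τ adm ,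
    λ k → to (cornerCount-shift {τ = τ} {τ′ = dropLayer τ} (λ _ _ → refl) (toℕ k) (a k)) (corners k)

  restore : RHSTerms n π a → LHSTerms n π a
  restore (ρ , ρ⊆π , τ , adm , corners) =
    prependLayer π τ τ₀⊆π , prependLayer-admissible {π = π} {ρ = ρ} τ τ₀⊆π adm ,
    λ k → from (cornerCount-shift {τ = prependLayer π τ τ₀⊆π} {τ′ = τ} (λ _ _ → refl) (toℕ k) (a k)) (corners k)
    where
    τ₀⊆π : layer τ 0 ⊆ᴰ π
    τ₀⊆π = layer-⊆ᴰ ρ τ adm {π} ρ⊆π 0

  remove-cong : Congruent _≈ᴸ_ _≈ᴿ_ remove
  remove-cong {τ , _} {σ , _} τ≈σ = (λ r → τ≈σ (1 ∷ r)) , dropLayer-cong {τ = τ} {σ = σ} τ≈σ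

  restore-cong : Congruent _≈ᴿ_ _≈ᴸ_ restore
  restore-cong {ρ , ρ⊆π , τ , adm , _} {ρ′ , ρ′⊆π , σ , adm′ , _} (_ , τ≈σ) =
    prependLayer-cong (layer-⊆ᴰ ρ τ adm {π} ρ⊆π 0) (layer-⊆ᴰ ρ′ σ adm′ {π} ρ′⊆π 0) τ≈σ

  remove-restore : StrictlyInverseˡ _≈ᴿ_ remove restore
  remove-restore (ρ , ρ⊆π , τ , adm , _) =
    layer₀≈shadow ρ τ adm , dropLayer-prependLayer {π = π} {τ = τ} (layer-⊆ᴰ ρ τ adm {π} ρ⊆π 0)

  restore-remove : StrictlyInverseʳ _≈ᴸ_ remove restore
  restore-remove (τ , adm , _) = prependLayer-dropLayer π τ adm
    (layer-⊆ᴰ (layer τ 1) (dropLayer τ) (dropLayer-admissible {ρ = π} τ adm) {π} (layer-⊆ᴰ-shadow π τ adm 1) 0)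

  remove-inverseˡ : Inverseˡ _≈ᴸ_ _≈ᴿ_ remove restore
  remove-inverseˡ {x} {y} = strictlyInverseˡ⇒inverseˡ {f = remove} {f⁻¹ = restore}
    (λ {x} {y} → remove-cong {x} {y}) remove-restore {x} {y}

  remove-inverseʳ : Inverseʳ _≈ᴸ_ _≈ᴿ_ remove restore
  remove-inverseʳ {x} {y} = strictlyInverseʳ⇒inverseʳ {f⁻¹ = restore} {f = remove}
    (λ {x} {y} → restore-cong {x} {y}) restore-remove {x} {y}

lemma6p6 : (e : ℕ) (π : Partition e) (n : ℕ) (a : Fin n → ℕ) →
    Inverse (LHSSetoid n π a) (RHSSetoid n π a)
lemma6p6 e π n a = record
  { to        = remove
  ; from      = restore
  ; to-cong   = λ {x} {y} → remove-cong {x} {y}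
  ; from-cong = λ {x} {y} → restore-cong {x} {y}
  ; inverse   = (λ {x} {y} → remove-inverseˡ {x} {y}) , (λ {x} {y} → remove-inverseʳ {x} {y})
  }
  where open FirstLayer π n a
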